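{- Let $X$ be a finite set with $|X|\ge3$ and $\mathfrak{C}$ the set of partial choice functions on pairs from $X$. If $\mathscr{C}\subseteq\mathfrak{C}$ is symmetric and chaotic, then $\operatorname{maj}^{\mathrm{cl}}(\mathscr{C})=\mathfrak{C}$.
   Context: $\mathfrak{C}$ is the set of all functions $c\colon Y\to X$ with $Y\subseteq\binom{X}{2}$ and $c\{x,y\}\in\{x,y\}$. $W^x_y(c)$ is $1$ if $c\{x,y\}=x$, $-1$ if $c\{x,y\}=y$, $0$ if $\{x,y\}\notin\operatorname{dom}c$ (including $x=y$). $\mathscr{C}$ is symmetric if closed under $c\mapsto c^\sigma$ for permutations $\sigma$ of $X$, where $c^\sigma\{\sigma(x),\sigma(y)\}=\sigma(x)$ iff $c\{x,y\}=x$. $c$ is balanced if $\sum_y W^x_y(c)=0$ for all $x$, imbalanced otherwise; $c$ is partisan if there is nonempty $W\subsetneq X$ with $c\{x,y\}=x\iff(x\in W\text{ and }y\notin W)$; $c$ is chaotic if it is imbalanced and not partisan; $\mathscr{C}$ is chaotic if it contains a chaotic function. $\operatorname{maj}^{\mathrm{cl}}(\mathscr{C})$ is the set of $d\in\mathfrak{C}$ for which there are rationals $r_c\in[0,1]$ with $\sum_c r_c=1$ and $d\{x,y\}=x\iff\sum_c W^x_y(c)r_c>0$. -}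

module Defs where

open import Data.Nat using (ℕ)
open import Data.Fin using (Fin; _≟_)
open import Data.Fin.Permutation using (Permutation′; _⟨$⟩ʳ_; _⟨$⟩ˡ_)
open import Data.Maybe using (Maybe; just; nothing)
import Data.Maybe as Maybe
open import Data.Bool using (Bool; true; false)
open import Data.Integer using (ℤ; 0ℤ; 1ℤ; -1ℤ)
import Data.Integer as ℤ
open import Data.Rational using (ℚ; 0ℚ; 1ℚ; _≤_; _<_; _*_; _+_)
import Data.Rational as ℚ
open import Data.List using (List; []; _∷_; map; foldr)
open import Data.List.Relation.Unary.All using (All)
open import Data.Product using (Σ; ∃; _×_; _,_; proj₁; proj₂)
open import Data.Sum using (_⊎_)
open import Relation.Nullary using (¬_; yes; no)
open import Relation.Binary.PropositionalEquality using (_≡_)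
open import Function.Bundles using (_⇔_)

-- The finite set X is modelled as Fin n.
-- A (raw) partial choice function: c x y = c{x,y} (nothing if {x,y} ∉ dom c).
RawC : ℕ → Set
RawC n = Fin n → Fin n → Maybe (Fin n)

-- c is an element of 𝔠: defined on unordered pairs of distinct elements,
-- choosing one of the two.
IsChoice : ∀ {n} → RawC n → Set
IsChoice {n} c =
  (∀ (x y : Fin n) → c x y ≡ c y x) ×
  (∀ (x : Fin n) → c x x ≡ nothing) ×
  (∀ (x y z : Fin n) → c x y ≡ just z → z ≡ x ⊎ z ≡ y)

W : ∀ {n} → Fin n → Fin n → RawC n → ℤ
W x y c with c x y
... | nothing = 0ℤ
... | just z with z ≟ x
...   | yes _ = 1ℤ
...   | no  _ = -1ℤ

sumFin : ∀ n → (Fin n → ℤ) → ℤ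
sumFin ℕ.zero f = 0ℤ
sumFin (ℕ.suc n) f = f Fin.zero ℤ.+ sumFin n (λ i → f (Fin.suc i))

Balanced : ∀ {n} → RawC n → Set
Balanced {n} c = ∀ (x : Fin n) → sumFin n (λ y → W x y c) ≡ 0ℤ

Imbalanced : ∀ {n} → RawC n → Set
Imbalanced c = ¬ Balanced c

-- W ⊆ X given by its characteristic function w; nonempty and proper.
Partisan : ∀ {n} → RawC n → Set
Partisan {n} c = Σ (Fin n → Bool) λ w →
  (∃ λ x → w x ≡ true) × (∃ λ x → w x ≡ false) ×
  (∀ (x y : Fin n) → (c x y ≡ just x) ⇔ (w x ≡ true × w y ≡ false))

Chaotic : ∀ {n} → RawC n → Set
Chaotic c = Imbalanced c × ¬ Partisan c

-- c^σ : c^σ{σx,σy} = σ(c{x,y})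
act : ∀ {n} → Permutation′ n → RawC n → RawC n
act σ c x y = Maybe.map (σ ⟨$⟩ʳ_) (c (σ ⟨$⟩ˡ x) (σ ⟨$⟩ˡ y))

Family : ℕ → Set₁
Family n = RawC n → Set

IsSubsetOf𝔠 : ∀ {n} → Family n → Set
IsSubsetOf𝔠 {n} 𝒞 = ∀ (c : RawC n) → 𝒞 c → IsChoice c

Symmetric : ∀ {n} → Family n → Set
Symmetric {n} 𝒞 = ∀ (c : RawC n) → 𝒞 c → ∀ (σ : Permutation′ n) → 𝒞 (act σ c)

ChaoticFamily : ∀ {n} → Family n → Set
ChaoticFamily {n} 𝒞 = ∃ λ (c : RawC n) → 𝒞 c × Chaotic c

-- Rational weights: a finite list of (c , r_c) with c ∈ 𝒞, r_c ∈ [0,1], Σ r_c = 1.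
Weights : ℕ → Set
Weights n = List (RawC n × ℚ)

weightSum : ∀ {n} → Weights n → ℚ
weightSum = foldr (λ p s → proj₂ p + s) 0ℚ

weightedW : ∀ {n} → Fin n → Fin n → Weights n → ℚ
weightedW x y = foldr (λ p s → (ℚ._/_ (W x y (proj₁ p)) 1) * proj₂ p + s) 0ℚ

InMajCl : ∀ {n} → Family n → RawC n → Set
InMajCl {n} 𝒞 d = Σ (Weights n) λ L →
  All (λ p → 𝒞 (proj₁ p) × 0ℚ ≤ proj₂ p × proj₂ p ≤ 1ℚ) L ×
  weightSum L ≡ 1ℚ ×
  (∀ (x y : Fin n) → (d x y ≡ just x) ⇔ (0ℚ < weightedW x y L))

module Submission where

-- A choice function c is studied through its antisymmetric matrix
-- W(c) x y = W^x_y(c) ∈ {-1,0,1}.  If a nonempty list of members of 𝒞 has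
-- a matrix sum that is positive exactly where d chooses x from {x,y}, then
-- uniform weights put d into maj^cl(𝒞).  So we study Span 𝒞, the sums of
-- matrices W(c) with c ∈ 𝒞, which for symmetric 𝒞 is closed under
-- relabelling.

open import Defs
open import Data.Nat as ℕ using (ℕ; zero; suc; _∸_; _≥_; s≤s; z≤n)
import Data.Nat.Properties as ℕP
import Data.Nat.Tactic.RingSolver as ℕ-Solver
open import Data.Nat.Coprimality using (1-coprimeTo)
open import Data.Fin as F using (Fin; _≟_)
open import Data.Fin.Properties
  using (toℕ-injective; toℕ-lower₁; opposite-prop; toℕ<n; opposite-involutive; any?; ¬∀⟶∃¬)
open import Data.Fin.Permutation as P using (Permutation′; _⟨$⟩ʳ_; _⟨$⟩ˡ_; _∘ₚ_; permutation)
import Data.Fin.Permutation.Components as PC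
open import Data.Maybe using (Maybe; just; nothing)
import Data.Maybe as Maybe
open import Data.Maybe.Properties using (≡-dec)
open import Data.Integer as ℤ using (ℤ; 0ℤ; 1ℤ; -1ℤ; +_; -_; -[1+_]; _+_; _*_; _-_)
import Data.Integer.Properties as ℤP
open import Data.Integer.Tactic.RingSolver using (solve-∀)
open import Algebra.Properties.AbelianGroup ℤP.+-0-abelianGroup using (∙-cancelʳ)
open import Data.Rational as ℚ using (ℚ; mkℚ; 0ℚ; 1ℚ; toℚᵘ)
import Data.Rational.Properties as ℚP
open import Data.Rational.Unnormalised as ℚᵘ using (ℚᵘ; mkℚᵘ; *≡*; *<*)
import Data.Rational.Unnormalised.Properties as ℚᵘP
open import Data.List using (List; []; _∷_; map; foldr; _++_; length)
open import Data.List.Relation.Unary.All using (All; []; _∷_)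
import Data.List.Relation.Unary.All.Properties as AllP
open import Data.Product using (Σ; ∃; _×_; _,_; proj₁; proj₂)
open import Data.Sum using (_⊎_; inj₁; inj₂)
open import Data.Bool using (Bool; true; false)
open import Data.Empty using (⊥; ⊥-elim)
open import Relation.Nullary using (¬_; yes; no; Dec; does)
open import Relation.Nullary.Decidable using (decidable-stable; ¬?)
open import Relation.Binary.PropositionalEquality
open import Function.Bundles using (_⇔_; mk⇔; Equivalence)

Matrix : ℕ → Set
Matrix n = Fin n → Fin n → ℤ

Antisymmetric : ∀ {n} → Matrix n → Set
Antisymmetric u = ∀ x y → u y x ≡ - u x y

self-negating⇒0 : ∀ a → a ≡ - a → a ≡ 0ℤ
self-negating⇒0 a a≡-a =
  ℤP.*-cancelˡ-≡ (+ 2) a 0ℤ (trans (double a) (trans (cong (_+_ a) a≡-a) (ℤP.+-inverseʳ a)))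
  where double : ∀ a → + 2 * a ≡ a + a
        double = solve-∀

antisym⇒diag : ∀ {n} {u : Matrix n} → Antisymmetric u → ∀ x → u x x ≡ 0ℤ
antisym⇒diag {u = u} anti x = self-negating⇒0 (u x x) (anti x x)

sum-cong : ∀ n {f g : Fin n → ℤ} → (∀ i → f i ≡ g i) → sumFin n f ≡ sumFin n g
sum-cong zero    eq = refl
sum-cong (suc n) eq = cong₂ _+_ (eq F.zero) (sum-cong n (λ i → eq (F.suc i)))

sum-const : ∀ n k → sumFin n (λ _ → k) ≡ + n * k
sum-const zero    k = sym (ℤP.*-zeroˡ k)
sum-const (suc n) k = begin
  k + sumFin n (λ _ → k) ≡⟨ cong (_+_ k) (sum-const n k) ⟩
  k + + n * k            ≡⟨ cong (λ w → w + + n * k) (sym (ℤP.*-identityˡ k)) ⟩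
  + 1 * k + + n * k      ≡⟨ sym (ℤP.*-distribʳ-+ k (+ 1) (+ n)) ⟩
  + suc n * k            ∎
  where open ≡-Reasoning

sum-zero : ∀ n → sumFin n (λ _ → 0ℤ) ≡ 0ℤ
sum-zero n = trans (sum-const n 0ℤ) (ℤP.*-zeroʳ (+ n))

sum-+ : ∀ n (f g : Fin n → ℤ) → sumFin n (λ i → f i + g i) ≡ sumFin n f + sumFin n g
sum-+ zero    f g = refl
sum-+ (suc n) f g =
  trans (cong (_+_ (f F.zero + g F.zero)) (sum-+ n (λ i → f (F.suc i)) (λ i → g (F.suc i))))
        (interchange (f F.zero) (g F.zero) _ _)
  where
  interchange : ∀ a b c d → a + b + (c + d) ≡ a + c + (b + d)
  interchange = solve-∀

sum-scale : ∀ n (k : ℤ) (f : Fin n → ℤ) → sumFin n (λ i → k * f i) ≡ k * sumFin n f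
sum-scale zero    k f = sym (ℤP.*-zeroʳ k)
sum-scale (suc n) k f = trans (cong (_+_ (k * f F.zero)) (sum-scale n k (λ i → f (F.suc i))))
                              (sym (ℤP.*-distribˡ-+ k (f F.zero) _))

sum-neg : ∀ n (f : Fin n → ℤ) → sumFin n (λ i → - f i) ≡ - sumFin n f
sum-neg n f = trans (sum-cong n (λ i → sym (ℤP.-1*i≡-i (f i))))
                    (trans (sum-scale n (- 1ℤ) f) (ℤP.-1*i≡-i (sumFin n f)))

sum-swap : ∀ n m (f : Fin n → Fin m → ℤ) →
  sumFin n (λ i → sumFin m (f i)) ≡ sumFin m (λ j → sumFin n (λ i → f i j))
sum-swap zero    m f = sym (sum-zero m)
sum-swap (suc n) m f = trans (cong (_+_ (sumFin m (f F.zero))) (sum-swap n m (λ i → f (F.suc i))))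
                             (sym (sum-+ m (f F.zero) _))

𝟙 : ∀ {A : Set} → Dec A → ℤ
𝟙 (yes _) = 1ℤ
𝟙 (no _)  = 0ℤ

𝟙-yes : ∀ {A : Set} (d : Dec A) → A → 𝟙 d ≡ 1ℤ
𝟙-yes (yes _) _ = refl
𝟙-yes (no ¬a) a = ⊥-elim (¬a a)

𝟙-no : ∀ {A : Set} (d : Dec A) → ¬ A → 𝟙 d ≡ 0ℤ
𝟙-no (yes a) ¬a = ⊥-elim (¬a a)
𝟙-no (no _)  _  = refl

δ : ∀ {n} → Fin n → Fin n → ℤ
δ a x = 𝟙 (x ≟ a)

δ-diff : ∀ {n} (a x : Fin n) → x ≢ a → δ a x ≡ 0ℤ
δ-diff a x = 𝟙-no (x ≟ a)

sum-δ : ∀ n (b : Fin n) (f : Fin n → ℤ) → sumFin n (λ y → δ y b * f y) ≡ f b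
sum-δ (suc n) F.zero f = begin
  1ℤ * f F.zero + sumFin n (λ y → 0ℤ * f (F.suc y)) ≡⟨ cong₂ _+_ (ℤP.*-identityˡ (f F.zero)) (sum-cong n (λ y → ℤP.*-zeroˡ (f (F.suc y)))) ⟩
  f F.zero + sumFin n (λ _ → 0ℤ)                   ≡⟨ cong (_+_ (f F.zero)) (sum-zero n) ⟩
  f F.zero + 0ℤ                                    ≡⟨ ℤP.+-identityʳ _ ⟩
  f F.zero                                         ∎
  where open ≡-Reasoning
sum-δ (suc n) (F.suc b) f = begin
  0ℤ * f F.zero + sumFin n (λ y → δ (F.suc y) (F.suc b) * f (F.suc y)) ≡⟨ ℤP.+-identityˡ _ ⟩
  sumFin n (λ y → δ (F.suc y) (F.suc b) * f (F.suc y))                 ≡⟨ sum-cong n (λ y → cong (_* f (F.suc y)) (δ-suc y b)) ⟩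
  sumFin n (λ y → δ y b * f (F.suc y))                                 ≡⟨ sum-δ n b (λ y → f (F.suc y)) ⟩
  f (F.suc b)                                                          ∎
  where
  open ≡-Reasoning
  δ-suc : ∀ {n} (a x : Fin n) → δ (F.suc a) (F.suc x) ≡ δ a x
  δ-suc a x with x ≟ a
  ... | yes _ = refl
  ... | no _  = refl

sum-δ₂ : ∀ n (α β : ℤ) (u w : Fin n) (G H : Fin n → ℤ) →
  sumFin n (λ y → α * (δ y u * G y) - β * (δ y w * H y)) ≡ α * G u - β * H w
sum-δ₂ n α β u w G H = begin
  sumFin n (λ y → α * (δ y u * G y) - β * (δ y w * H y))
    ≡⟨ sum-+ n (λ y → α * (δ y u * G y)) (λ y → - (β * (δ y w * H y))) ⟩
  sumFin n (λ y → α * (δ y u * G y)) + sumFin n (λ y → - (β * (δ y w * H y)))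
    ≡⟨ cong₂ _+_ (trans (sum-scale n α _) (cong (α *_) (sum-δ n u G)))
                 (trans (sum-neg n _) (cong -_ (trans (sum-scale n β _) (cong (β *_) (sum-δ n w H))))) ⟩
  α * G u - β * H w ∎
  where open ≡-Reasoning

Wᵛ : ∀ {n} → Fin n → Maybe (Fin n) → ℤ
Wᵛ x nothing  = 0ℤ
Wᵛ x (just z) with z ≟ x
... | yes _ = 1ℤ
... | no _  = -1ℤ

W≡Wᵛ : ∀ {n} (x y : Fin n) (c : RawC n) → W x y c ≡ Wᵛ x (c x y)
W≡Wᵛ x y c with c x y
... | nothing = refl
... | just z with z ≟ x
...   | yes _ = refl
...   | no _  = refl

Wmat : ∀ {n} → RawC n → Matrix n
Wmat c x y = W x y c

W-antisym : ∀ {n} (c : RawC n) → IsChoice c → Antisymmetric (Wmat c)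
W-antisym c (c-sym , c-diag , c-val) x y
  rewrite W≡Wᵛ y x c | W≡Wᵛ x y c | c-sym y x with c x y in eq
... | nothing = refl
... | just z with x ≟ y
...   | yes refl with trans (sym (c-diag x)) eq
...     | ()
W-antisym c (c-sym , c-diag , c-val) x y | just z | no x≢y with c-val x y z eq
... | inj₁ refl with z ≟ z | z ≟ y
...   | yes _  | no _    = refl
...   | no z≢z | _       = ⊥-elim (z≢z refl)
...   | yes _  | yes z≡y = ⊥-elim (x≢y z≡y)
W-antisym c (c-sym , c-diag , c-val) x y | just z | no x≢y | inj₂ refl with z ≟ z | z ≟ x
...   | yes _  | no _    = refl
...   | no z≢z | _       = ⊥-elim (z≢z refl)
...   | yes _  | yes z≡x = ⊥-elim (x≢y (sym z≡x))

W-values : ∀ {n} (x y : Fin n) (c : RawC n) → W x y c ≡ 1ℤ ⊎ W x y c ≡ 0ℤ ⊎ W x y c ≡ -1ℤ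
W-values x y c rewrite W≡Wᵛ x y c with c x y
... | nothing = inj₂ (inj₁ refl)
... | just z with z ≟ x
...   | yes _ = inj₁ refl
...   | no _  = inj₂ (inj₂ refl)

W≡1⇒chooses : ∀ {n} (x y : Fin n) (c : RawC n) → W x y c ≡ 1ℤ → c x y ≡ just x
W≡1⇒chooses x y c eq rewrite W≡Wᵛ x y c with c x y
W≡1⇒chooses x y c () | nothing
... | just z with z ≟ x
...   | yes refl = refl
W≡1⇒chooses x y c () | just z | no _

chooses⇒W≡1 : ∀ {n} (x y : Fin n) (c : RawC n) → c x y ≡ just x → W x y c ≡ 1ℤ
chooses⇒W≡1 x y c eq rewrite W≡Wᵛ x y c | eq with x ≟ x
... | yes _  = refl
... | no x≢x = ⊥-elim (x≢x refl)

relabel : ∀ {n} → Permutation′ n → Matrix n → Matrix n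
relabel π u x y = u (π ⟨$⟩ˡ x) (π ⟨$⟩ˡ y)

ˡ-injective : ∀ {n} (π : Permutation′ n) {x y} → π ⟨$⟩ˡ x ≡ π ⟨$⟩ˡ y → x ≡ y
ˡ-injective π {x} {y} eq = trans (sym (P.inverseʳ π)) (trans (cong (π ⟨$⟩ʳ_) eq) (P.inverseʳ π))

Wmat-act : ∀ {n} (π : Permutation′ n) (c : RawC n) x y → Wmat (act π c) x y ≡ relabel π (Wmat c) x y
Wmat-act π c x y = trans (W≡Wᵛ x y (act π c))
                         (trans (Wᵛ-map (c (π ⟨$⟩ˡ x) (π ⟨$⟩ˡ y))) (sym (W≡Wᵛ _ _ c)))
  where
  Wᵛ-map : ∀ m → Wᵛ x (Maybe.map (π ⟨$⟩ʳ_) m) ≡ Wᵛ (π ⟨$⟩ˡ x) m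
  Wᵛ-map nothing = refl
  Wᵛ-map (just z) with π ⟨$⟩ʳ z ≟ x | z ≟ π ⟨$⟩ˡ x
  ... | yes _ | yes _ = refl
  ... | no _  | no _  = refl
  ... | yes πz≡x | no z≢πx = ⊥-elim (z≢πx (trans (sym (P.inverseˡ π)) (cong (π ⟨$⟩ˡ_) πz≡x)))
  ... | no πz≢x | yes z≡πx = ⊥-elim (πz≢x (trans (cong (π ⟨$⟩ʳ_) z≡πx) (P.inverseʳ π)))

δ-relabel : ∀ {n} (π : Permutation′ n) (a x : Fin n) → δ (π ⟨$⟩ˡ a) (π ⟨$⟩ˡ x) ≡ δ a x
δ-relabel π a x with π ⟨$⟩ˡ x ≟ π ⟨$⟩ˡ a | x ≟ a
... | yes _ | yes _ = refl
... | no _  | no _  = refl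
... | yes πx≡πa | no x≢a = ⊥-elim (x≢a (ˡ-injective π πx≡πa))
... | no πx≢πa | yes x≡a = ⊥-elim (πx≢πa (cong (π ⟨$⟩ˡ_) x≡a))

transpose-i : ∀ {n} (i j : Fin n) → PC.transpose i j i ≡ j
transpose-i i j with i ≟ i
... | yes _  = refl
... | no i≢i = ⊥-elim (i≢i refl)

transpose-other : ∀ {n} (i j k : Fin n) → k ≢ i → k ≢ j → PC.transpose i j k ≡ k
transpose-other i j k k≢i k≢j with k ≟ i
... | yes k≡i = ⊥-elim (k≢i k≡i)
... | no _ with k ≟ j
...   | yes k≡j = ⊥-elim (k≢j k≡j)
...   | no _    = refl

-- Extend a permutation sending a ↦ a' by a transposition so that it also
-- sends a given b ↦ b', keeping every point whose image avoids πˡb and b'.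
redirect : ∀ {n} (π : Permutation′ n) (b b' : Fin n) → Permutation′ n
redirect π b b' = P.transpose b' (π ⟨$⟩ˡ b) ∘ₚ π

redirect-new : ∀ {n} (π : Permutation′ n) (b b' : Fin n) → redirect π b b' ⟨$⟩ˡ b ≡ b'
redirect-new π b b' = transpose-i (π ⟨$⟩ˡ b) b'

redirect-old : ∀ {n} (π : Permutation′ n) (b b' a : Fin n) → a ≢ b → π ⟨$⟩ˡ a ≢ b' →
  redirect π b b' ⟨$⟩ˡ a ≡ π ⟨$⟩ˡ a
redirect-old π b b' a a≢b πa≢b' =
  transpose-other (π ⟨$⟩ˡ b) b' (π ⟨$⟩ˡ a) (λ eq → a≢b (ˡ-injective π eq)) πa≢b'

two-transitive : ∀ {n} {a b a' b' : Fin n} → a ≢ b → a' ≢ b' →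
  Σ (Permutation′ n) λ π → π ⟨$⟩ˡ a ≡ a' × π ⟨$⟩ˡ b ≡ b'
two-transitive {a = a} {b} {a'} {b'} a≢b a'≢b' =
  redirect π₁ b b' , trans (redirect-old π₁ b b' a a≢b (λ eq → a'≢b' (trans (sym πa≡a') eq))) πa≡a'
                   , redirect-new π₁ b b'
  where
  π₁ : Permutation′ _
  π₁ = redirect P.id a a'
  πa≡a' : π₁ ⟨$⟩ˡ a ≡ a'
  πa≡a' = redirect-new P.id a a'

three-transitive : ∀ {n} {a b c a' b' c' : Fin n} →
  a ≢ b → a ≢ c → b ≢ c → a' ≢ b' → a' ≢ c' → b' ≢ c' →
  Σ (Permutation′ n) λ π → π ⟨$⟩ˡ a ≡ a' × π ⟨$⟩ˡ b ≡ b' × π ⟨$⟩ˡ c ≡ c'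
three-transitive {a = a} {b} {c} {a'} {b'} {c'} a≢b a≢c b≢c a'≢b' a'≢c' b'≢c'
  with two-transitive a≢b a'≢b'
... | π , πa≡a' , πb≡b' =
  redirect π c c' ,
  trans (redirect-old π c c' a a≢c (λ eq → a'≢c' (trans (sym πa≡a') eq))) πa≡a' ,
  trans (redirect-old π c c' b b≢c (λ eq → b'≢c' (trans (sym πb≡b') eq))) πb≡b' ,
  redirect-new π c c'

sumW : ∀ {n} → List (RawC n) → Matrix n
sumW L x y = foldr (λ c s → W x y c + s) 0ℤ L

Span : ∀ {n} → Family n → Matrix n → Set
Span {n} 𝒞 u = Σ (List (RawC n)) λ L → All 𝒞 L × (∀ x y → sumW L x y ≡ u x y)

sumW-++ : ∀ {n} (L₁ L₂ : List (RawC n)) x y → sumW (L₁ ++ L₂) x y ≡ sumW L₁ x y + sumW L₂ x y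
sumW-++ []       L₂ x y = sym (ℤP.+-identityˡ _)
sumW-++ (c ∷ L₁) L₂ x y = trans (cong (_+_ (W x y c)) (sumW-++ L₁ L₂ x y)) (sym (ℤP.+-assoc (W x y c) _ _))

module _ {n : ℕ} (𝒞 : Family n) where

  span-ext : ∀ {u v : Matrix n} → (∀ x y → u x y ≡ v x y) → Span 𝒞 u → Span 𝒞 v
  span-ext u≡v (L , L∈𝒞 , sum≡u) = L , L∈𝒞 , λ x y → trans (sum≡u x y) (u≡v x y)

  span-member : ∀ c → 𝒞 c → Span 𝒞 (Wmat c)
  span-member c c∈𝒞 = c ∷ [] , c∈𝒞 ∷ [] , λ x y → ℤP.+-identityʳ _

  span-0 : Span 𝒞 (λ _ _ → 0ℤ)
  span-0 = [] , [] , λ _ _ → refl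

  span-+ : ∀ {u v : Matrix n} → Span 𝒞 u → Span 𝒞 v → Span 𝒞 (λ x y → u x y + v x y)
  span-+ (L₁ , A₁ , e₁) (L₂ , A₂ , e₂) =
    L₁ ++ L₂ , AllP.++⁺ A₁ A₂ , λ x y → trans (sumW-++ L₁ L₂ x y) (cong₂ _+_ (e₁ x y) (e₂ x y))

  span-sum : ∀ m (F : Fin m → Matrix n) → (∀ i → Span 𝒞 (F i)) →
    Span 𝒞 (λ x y → sumFin m (λ i → F i x y))
  span-sum zero    F s = span-0
  span-sum (suc m) F s = span-+ (s F.zero) (span-sum m (λ i → F (F.suc i)) (λ i → s (F.suc i)))

  span-relabel : Symmetric 𝒞 → ∀ (π : Permutation′ n) {u : Matrix n} → Span 𝒞 u →
    Span 𝒞 (relabel π u)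
  span-relabel sym𝒞 π (L , L∈𝒞 , sum≡u) =
    map (act π) L , AllP.map⁺ (members L∈𝒞) , λ x y → trans (sumW-map L x y) (sum≡u _ _)
    where
    members : ∀ {L} → All 𝒞 L → All (λ c → 𝒞 (act π c)) L
    members []          = []
    members (c∈𝒞 ∷ L∈𝒞) = sym𝒞 _ c∈𝒞 π ∷ members L∈𝒞
    sumW-map : ∀ L x y → sumW (map (act π) L) x y ≡ sumW L (π ⟨$⟩ˡ x) (π ⟨$⟩ˡ y)
    sumW-map []      x y = refl
    sumW-map (c ∷ L) x y = cong₂ _+_ (Wmat-act π c x y) (sumW-map L x y)

sumℕ : ℕ → (ℕ → ℤ) → ℤ
sumℕ zero    G = 0ℤ
sumℕ (suc k) G = G 0 + sumℕ k (λ i → G (suc i))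

sumℕ-cong : ∀ M {G H : ℕ → ℤ} → (∀ i → G i ≡ H i) → sumℕ M G ≡ sumℕ M H
sumℕ-cong zero    e = refl
sumℕ-cong (suc M) e = cong₂ _+_ (e 0) (sumℕ-cong M (λ i → e (suc i)))

sumℕ-neg : ∀ M (G : ℕ → ℤ) → sumℕ M (λ i → - G i) ≡ - sumℕ M G
sumℕ-neg zero    G = refl
sumℕ-neg (suc M) G = trans (cong (_+_ (- G 0)) (sumℕ-neg M (λ i → G (suc i))))
                           (sym (ℤP.neg-distrib-+ (G 0) _))

sumℕ-step : ∀ M (G : ℕ → ℤ) → sumℕ M (λ i → G (suc i)) + G 0 ≡ sumℕ M G + G M
sumℕ-step zero    G = refl
sumℕ-step (suc M) G = begin
  G 1 + S₂ + G 0           ≡⟨ regroup (G 1) S₂ (G 0) ⟩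
  G 0 + (S₂ + G 1)         ≡⟨ cong (_+_ (G 0)) (sumℕ-step M (λ i → G (suc i))) ⟩
  G 0 + (S₁ + G (suc M))   ≡⟨ sym (ℤP.+-assoc (G 0) S₁ _) ⟩
  G 0 + S₁ + G (suc M)     ∎
  where
  open ≡-Reasoning
  S₁ S₂ : ℤ
  S₁ = sumℕ M (λ i → G (suc i))
  S₂ = sumℕ M (λ i → G (suc (suc i)))
  regroup : ∀ a b c → a + b + c ≡ c + (b + a)
  regroup = solve-∀

sumℕ-shift : ∀ M j (H : ℕ → ℤ) → (∀ k → H (k ℕ.+ M) ≡ H k) →
  sumℕ M (λ k → H (k ℕ.+ j)) ≡ sumℕ M H
sumℕ-shift M zero    H periodic = sumℕ-cong M (λ k → cong H (ℕP.+-identityʳ k))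
sumℕ-shift M (suc j) H periodic = begin
  sumℕ M (λ k → H (k ℕ.+ suc j))   ≡⟨ sumℕ-cong M (λ k → cong H (ℕP.+-suc k j)) ⟩
  sumℕ M (λ k → H (suc k ℕ.+ j))   ≡⟨ shift-one ⟩
  sumℕ M (λ k → H (k ℕ.+ j))       ≡⟨ sumℕ-shift M j H periodic ⟩
  sumℕ M H                         ∎
  where
  open ≡-Reasoning
  G : ℕ → ℤ
  G k = H (k ℕ.+ j)
  shift-one : sumℕ M (λ k → G (suc k)) ≡ sumℕ M G
  shift-one = ∙-cancelʳ (G 0) _ _
    (trans (sumℕ-step M G) (cong (_+_ (sumℕ M G)) (trans (cong H (ℕP.+-comm M j)) (periodic j))))

-- The dihedral group acting on Fin (suc m)

module Dihedral (m : ℕ) where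
  N : ℕ
  N = suc m

  ρ : Fin N → Fin N
  ρ i with m ℕ.≟ F.toℕ i
  ... | yes _ = F.zero
  ... | no m≢i = F.suc (F.lower₁ i m≢i)

  ρ-last : ∀ i → F.toℕ i ≡ m → ρ i ≡ F.zero
  ρ-last i i≡m with m ℕ.≟ F.toℕ i
  ... | yes _  = refl
  ... | no m≢i = ⊥-elim (m≢i (sym i≡m))

  ρ-step : ∀ i → F.toℕ i ≢ m → F.toℕ (ρ i) ≡ suc (F.toℕ i)
  ρ-step i i≢m with m ℕ.≟ F.toℕ i
  ... | yes m≡i = ⊥-elim (i≢m (sym m≡i))
  ... | no m≢i  = cong suc (toℕ-lower₁ i m≢i)

  r : Fin N → Fin N
  r = F.opposite

  ρrρ : ∀ z → ρ (r (ρ z)) ≡ r z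
  ρrρ z with F.toℕ z ℕ.≟ m
  ... | yes z≡m = toℕ-injective (begin
        F.toℕ (ρ (r (ρ z)))  ≡⟨ cong (λ w → F.toℕ (ρ (r w))) (ρ-last z z≡m) ⟩
        F.toℕ (ρ (r F.zero)) ≡⟨ cong F.toℕ (ρ-last (r F.zero) (opposite-prop F.zero)) ⟩
        0                    ≡⟨ sym (ℕP.n∸n≡0 m) ⟩
        m ∸ m                ≡⟨ cong (m ∸_) (sym z≡m) ⟩
        m ∸ F.toℕ z          ≡⟨ sym (opposite-prop z) ⟩
        F.toℕ (r z)          ∎)
    where open ≡-Reasoning
  ... | no z≢m = toℕ-injective (begin
        F.toℕ (ρ (r (ρ z)))     ≡⟨ ρ-step (r (ρ z)) rρz≢m ⟩
        suc (F.toℕ (r (ρ z)))   ≡⟨ cong suc rρz≡ ⟩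
        suc (m ∸ suc (F.toℕ z)) ≡⟨ sym (ℕP.+-∸-assoc 1 z<m) ⟩
        m ∸ F.toℕ z             ≡⟨ sym (opposite-prop z) ⟩
        F.toℕ (r z)             ∎)
    where
    open ≡-Reasoning
    z<m : suc (F.toℕ z) ℕ.≤ m
    z<m = ℕP.≤∧≢⇒< (ℕP.≤-pred (toℕ<n z)) z≢m
    rρz≡ : F.toℕ (r (ρ z)) ≡ m ∸ suc (F.toℕ z)
    rρz≡ = trans (opposite-prop (ρ z)) (cong (m ∸_) (ρ-step z z≢m))
    rρz≢m : F.toℕ (r (ρ z)) ≢ m
    rρz≢m eq = ℕP.<-irrefl eq
      (subst (ℕ._< m) (sym rρz≡) (ℕP.∸-monoʳ-< {m} {suc (F.toℕ z)} {0} (ℕ.s≤s ℕ.z≤n) z<m))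

  rot : ℕ → Fin N → Fin N
  rot zero    i = i
  rot (suc k) i = ρ (rot k i)

  rot-+ : ∀ a b i → rot (a ℕ.+ b) i ≡ rot a (rot b i)
  rot-+ zero    b i = refl
  rot-+ (suc a) b i = cong ρ (rot-+ a b i)

  rot-suc : ∀ k i → rot (suc k) i ≡ rot k (ρ i)
  rot-suc k i = trans (cong (λ j → rot j i) (ℕP.+-comm 1 k)) (rot-+ k 1 i)

  toℕ-rot-0 : ∀ k → k ℕ.< N → F.toℕ (rot k F.zero) ≡ k
  toℕ-rot-0 zero    _           = refl
  toℕ-rot-0 (suc k) (ℕ.s≤s k<m) = trans (ρ-step (rot k F.zero) rotk≢m) (cong suc ih)
    where
    ih : F.toℕ (rot k F.zero) ≡ k
    ih = toℕ-rot-0 k (ℕP.m<n⇒m<1+n k<m)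
    rotk≢m : F.toℕ (rot k F.zero) ≢ m
    rotk≢m eq = ℕP.<-irrefl (trans (sym ih) eq) k<m

  rot-from-0 : ∀ b → rot (F.toℕ b) F.zero ≡ b
  rot-from-0 b = toℕ-injective (toℕ-rot-0 (F.toℕ b) (toℕ<n b))

  rot-N : ∀ i → rot N i ≡ i
  rot-N i = begin
    rot N i                                ≡⟨ cong (rot N) (sym (rot-from-0 i)) ⟩
    rot N (rot (F.toℕ i) F.zero)           ≡⟨ sym (rot-+ N (F.toℕ i) F.zero) ⟩
    rot (N ℕ.+ F.toℕ i) F.zero             ≡⟨ cong (λ j → rot j F.zero) (ℕP.+-comm N (F.toℕ i)) ⟩
    rot (F.toℕ i ℕ.+ N) F.zero             ≡⟨ rot-+ (F.toℕ i) N F.zero ⟩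
    rot (F.toℕ i) (rot N F.zero)           ≡⟨ cong (rot (F.toℕ i)) rot-N-0 ⟩
    rot (F.toℕ i) F.zero                   ≡⟨ rot-from-0 i ⟩
    i                                      ∎
    where
    open ≡-Reasoning
    rot-N-0 : rot N F.zero ≡ F.zero
    rot-N-0 = ρ-last (rot m F.zero) (toℕ-rot-0 m (ℕP.n<1+n m))

  rot-multiple : ∀ k i → rot (k ℕ.* N) i ≡ i
  rot-multiple zero    i = refl
  rot-multiple (suc k) i = trans (rot-+ N (k ℕ.* N) i) (trans (cong (rot N) (rot-multiple k i)) (rot-N i))

  rot-inverse : ∀ k i → rot k (rot (k ℕ.* m) i) ≡ i
  rot-inverse k i = trans (sym (rot-+ k (k ℕ.* m) i))
    (trans (cong (λ j → rot j i) (sym (ℕP.*-suc k m))) (rot-multiple k i))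

  rot-inverse′ : ∀ k i → rot (k ℕ.* m) (rot k i) ≡ i
  rot-inverse′ k i = trans (sym (rot-+ (k ℕ.* m) k i))
    (trans (cong (λ j → rot j i) (trans (ℕP.+-comm (k ℕ.* m) k) (sym (ℕP.*-suc k m))))
           (rot-multiple k i))

  reflection-involutive : ∀ k z → rot k (r (rot k z)) ≡ r z
  reflection-involutive zero    z = refl
  reflection-involutive (suc k) z = begin
    ρ (rot k (r (rot (suc k) z))) ≡⟨ cong (λ w → ρ (rot k (r w))) (rot-suc k z) ⟩
    ρ (rot k (r (rot k (ρ z))))   ≡⟨ cong ρ (reflection-involutive k (ρ z)) ⟩
    ρ (r (ρ z))                   ≡⟨ ρrρ z ⟩
    r z                           ∎
    where open ≡-Reasoning

  rot-transitive : ∀ a b → rot (F.toℕ b ℕ.+ (N ∸ F.toℕ a)) a ≡ b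
  rot-transitive a b = begin
    rot (F.toℕ b ℕ.+ (N ∸ F.toℕ a)) a                    ≡⟨ rot-+ (F.toℕ b) (N ∸ F.toℕ a) a ⟩
    rot (F.toℕ b) (rot (N ∸ F.toℕ a) a)                  ≡⟨ cong (λ w → rot (F.toℕ b) (rot (N ∸ F.toℕ a) w)) (sym (rot-from-0 a)) ⟩
    rot (F.toℕ b) (rot (N ∸ F.toℕ a) (rot (F.toℕ a) F.zero)) ≡⟨ cong (rot (F.toℕ b)) (sym (rot-+ (N ∸ F.toℕ a) (F.toℕ a) F.zero)) ⟩
    rot (F.toℕ b) (rot (N ∸ F.toℕ a ℕ.+ F.toℕ a) F.zero) ≡⟨ cong (λ j → rot (F.toℕ b) (rot j F.zero)) (ℕP.m∸n+n≡m (ℕP.<⇒≤ (toℕ<n a))) ⟩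
    rot (F.toℕ b) (rot N F.zero)                         ≡⟨ cong (rot (F.toℕ b)) (rot-N F.zero) ⟩
    rot (F.toℕ b) F.zero                                 ≡⟨ rot-from-0 b ⟩
    b                                                    ∎
    where open ≡-Reasoning

  -- The rotations x ↦ x + k and the reflections x ↦ k + m - x, given by
  -- their ⟨$⟩ˡ direction, which is the one relabelling uses.
  rotation : ℕ → Permutation′ N
  rotation k = permutation (rot (k ℕ.* m)) (rot k) (rot-inverse′ k) (rot-inverse k)

  reflection : ℕ → Permutation′ N
  reflection k = permutation (λ i → r (rot (k ℕ.* m) i)) (λ i → rot k (r i))
    (λ i → trans (cong r (rot-inverse′ k (r i))) (opposite-involutive i))
    (λ i → trans (cong (rot k) (opposite-involutive (rot (k ℕ.* m) i))) (rot-inverse k i))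

  -- For antisymmetric u, the sum of u over all reflections is minus its sum
  -- over all rotations: for fixed x,y some reflection swaps x and y, and
  -- composing it with the rotations enumerates the reflections.
  reflections-cancel-rotations : ∀ (u : Matrix N) → Antisymmetric u → ∀ x y →
    sumℕ N (λ k → relabel (reflection k) u x y) ≡ - sumℕ N (λ k → relabel (rotation k) u x y)
  reflections-cancel-rotations u anti x y = begin
    sumℕ N H                                   ≡⟨ sym (sumℕ-shift N j H periodic) ⟩
    sumℕ N (λ k → H (k ℕ.+ j))                 ≡⟨ sumℕ-cong N swapped ⟩
    sumℕ N (λ k → - u (rot k x) (rot k y))     ≡⟨ sumℕ-neg N (λ k → u (rot k x) (rot k y)) ⟩
    - sumℕ N (λ k → u (rot k x) (rot k y))     ∎
    where
    open ≡-Reasoning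
    H : ℕ → ℤ
    H k = u (rot k (r x)) (rot k (r y))
    periodic : ∀ k → H (k ℕ.+ N) ≡ H k
    periodic k = cong₂ u (trans (rot-+ k N (r x)) (cong (rot k) (rot-N (r x))))
                         (trans (rot-+ k N (r y)) (cong (rot k) (rot-N (r y))))
    j : ℕ
    j = F.toℕ y ℕ.+ (N ∸ F.toℕ (r x))
    rx↦y : rot j (r x) ≡ y
    rx↦y = rot-transitive (r x) y
    ry↦x : rot j (r y) ≡ x
    ry↦x = trans (cong (λ w → rot j (r w)) (sym rx↦y))
                 (trans (reflection-involutive j (r x)) (opposite-involutive x))
    swapped : ∀ k → H (k ℕ.+ j) ≡ - u (rot k x) (rot k y)
    swapped k = trans (cong₂ u (trans (rot-+ k j (r x)) (cong (rot k) rx↦y))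
                               (trans (rot-+ k j (r y)) (cong (rot k) ry↦x)))
                      (anti (rot k x) (rot k y))

-- The span of a symmetric family of choice functions is a ℤ-module

module _ {n : ℕ} (𝒞 : Family n) where

  span-sumℕ : ∀ M (G : ℕ → Matrix n) → (∀ k → Span 𝒞 (G k)) →
    Span 𝒞 (λ x y → sumℕ M (λ k → G k x y))
  span-sumℕ zero    G s = span-0 𝒞
  span-sumℕ (suc M) G s = span-+ 𝒞 (s 0) (span-sumℕ M (λ k → G (suc k)) (λ k → s (suc k)))

  NegationClosed : Set
  NegationClosed = ∀ c → 𝒞 c → Span 𝒞 (λ x y → - Wmat c x y)

  span-neg : NegationClosed → ∀ {u : Matrix n} → Span 𝒞 u → Span 𝒞 (λ x y → - u x y)
  span-neg neg (L , L∈𝒞 , sum≡u) = span-ext 𝒞 (λ x y → cong -_ (sum≡u x y)) (go L L∈𝒞)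
    where
    go : ∀ L → All 𝒞 L → Span 𝒞 (λ x y → - sumW L x y)
    go [] [] = span-ext 𝒞 (λ _ _ → refl) (span-0 𝒞)
    go (c ∷ L) (c∈𝒞 ∷ L∈𝒞) =
      span-ext 𝒞 (λ x y → sym (ℤP.neg-distrib-+ (W x y c) (sumW L x y))) (span-+ 𝒞 (neg c c∈𝒞) (go L L∈𝒞))

  span-ℕscale : ∀ (k : ℕ) {u : Matrix n} → Span 𝒞 u → Span 𝒞 (λ x y → + k * u x y)
  span-ℕscale zero    {u} s = span-ext 𝒞 (λ x y → sym (ℤP.*-zeroˡ (u x y))) (span-0 𝒞)
  span-ℕscale (suc k) {u} s = span-ext 𝒞 (λ x y → sym (ℤP.suc-* (+ k) (u x y))) (span-+ 𝒞 s (span-ℕscale k s))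

  span-scale : NegationClosed → ∀ (k : ℤ) {u : Matrix n} → Span 𝒞 u → Span 𝒞 (λ x y → k * u x y)
  span-scale neg (+ k)     s = span-ℕscale k s
  span-scale neg -[1+ k ] {u} s =
    span-ext 𝒞 (λ x y → ℤP.neg-distribˡ-* (+ suc k) (u x y)) (span-neg neg (span-ℕscale (suc k) s))

-- In a symmetric family of choice functions, -W(c) is the sum of W(c)
-- over the non-trivial rotations and all the reflections of X.
negation-closed : ∀ m (𝒞 : Family (suc m)) → IsSubsetOf𝔠 𝒞 → Symmetric 𝒞 → NegationClosed 𝒞
negation-closed m 𝒞 sub sym𝒞 c c∈𝒞 = span-ext 𝒞 total (span-+ 𝒞 rotations reflections)
  where
  open Dihedral m
  u : Matrix N
  u = Wmat c
  image : ∀ π → Span 𝒞 (relabel π u)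
  image π = span-relabel 𝒞 sym𝒞 π (span-member 𝒞 c c∈𝒞)
  rotations : Span 𝒞 (λ x y → sumℕ m (λ k → relabel (rotation (suc k)) u x y))
  rotations = span-sumℕ 𝒞 m _ (λ k → image (rotation (suc k)))
  reflections : Span 𝒞 (λ x y → sumℕ N (λ k → relabel (reflection k) u x y))
  reflections = span-sumℕ 𝒞 N _ (λ k → image (reflection k))
  total : ∀ x y → sumℕ m (λ k → relabel (rotation (suc k)) u x y) + sumℕ N (λ k → relabel (reflection k) u x y)
                  ≡ - u x y
  total x y rewrite reflections-cancel-rotations u (W-antisym c (sub c c∈𝒞)) x y =
    cancel (u x y) (sumℕ m (λ k → relabel (rotation (suc k)) u x y))
    where cancel : ∀ a b → b + - (a + b) ≡ - a
          cancel = solve-∀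

-- Cyclic sums: the obstruction to being a potential difference

cyc : ∀ {n} → Matrix n → Fin n → Fin n → Fin n → ℤ
cyc u a b d = u a b + u b d + u d a

module _ {n} {u : Matrix n} (anti : Antisymmetric u) where

  cyc-aad : ∀ a d → cyc u a a d ≡ 0ℤ
  cyc-aad a d rewrite antisym⇒diag anti a | anti a d | ℤP.+-identityˡ (u a d) = ℤP.+-inverseʳ (u a d)

  cyc-abb : ∀ a b → cyc u a b b ≡ 0ℤ
  cyc-abb a b rewrite antisym⇒diag anti b | anti a b | ℤP.+-identityʳ (u a b) = ℤP.+-inverseʳ (u a b)

  cyc-aba : ∀ a b → cyc u a b a ≡ 0ℤ
  cyc-aba a b rewrite antisym⇒diag anti a | anti a b | ℤP.+-inverseʳ (u a b) = refl

  cyc≢0⇒distinct : ∀ {a b d} → cyc u a b d ≢ 0ℤ → a ≢ b × a ≢ d × b ≢ d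
  cyc≢0⇒distinct {a} {b} {d} ne =
    (λ { refl → ne (cyc-aad a d) }) , (λ { refl → ne (cyc-aba a b) }) , (λ { refl → ne (cyc-abb a b) })

  flat⇒potential : (∀ a b d → cyc u a b d ≡ 0ℤ) → ∀ o x y → u x y ≡ u x o - u y o
  flat⇒potential flat o x y = begin
    u x y                           ≡⟨ solve-for-uxy (u x y) (u y o) (u o x) ⟩
    u x y + u y o + u o x - u o x - u y o ≡⟨ cong (λ s → s - u o x - u y o) (flat x y o) ⟩
    0ℤ - u o x - u y o              ≡⟨ cong (λ s → 0ℤ - s - u y o) (anti x o) ⟩
    0ℤ - - u x o - u y o            ≡⟨ tidy (u x o) (u y o) ⟩
    u x o - u y o                   ∎
    where
    open ≡-Reasoning
    solve-for-uxy : ∀ a b c → a ≡ a + b + c - c - b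
    solve-for-uxy = solve-∀
    tidy : ∀ a b → 0ℤ - - a - b ≡ a - b
    tidy = solve-∀

module _ {n : ℕ} (c : RawC n) (f : Fin n → ℤ) (h : ℤ)
         (potential : ∀ x y → W x y c ≡ f x - f y) (level : ∀ x → f x ≡ h ⊎ f x ≡ h - 1ℤ) where

  winner : Fin n → Bool
  winner x = does (f x ℤ.≟ h)

  winner-top : ∀ {x} → f x ≡ h → winner x ≡ true
  winner-top {x} eq with f x ℤ.≟ h
  ... | yes _  = refl
  ... | no f≢h = ⊥-elim (f≢h eq)

  step-down : ∀ a → a - 1ℤ - a ≡ -1ℤ
  step-down = solve-∀

  h≢h-1 : h ≢ h - 1ℤ
  h≢h-1 h≡h-1 with trans (sym (ℤP.+-inverseʳ h)) (trans (cong (_- h) h≡h-1) (step-down h))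
  ... | ()

  winner-bottom : ∀ {x} → f x ≡ h - 1ℤ → winner x ≡ false
  winner-bottom {x} eq with f x ℤ.≟ h
  ... | yes f≡h = ⊥-elim (h≢h-1 (trans (sym f≡h) eq))
  ... | no _    = refl

  chosen⇒top-to-bottom : ∀ x y → c x y ≡ just x → winner x ≡ true × winner y ≡ false
  chosen⇒top-to-bottom x y chosen = placed (level x) (level y)
    where
    forced : ∀ {v} → f x - f y ≡ v → v ≡ 1ℤ
    forced eq = trans (sym eq) (trans (sym (potential x y)) (chooses⇒W≡1 x y c chosen))
    placed : f x ≡ h ⊎ f x ≡ h - 1ℤ → f y ≡ h ⊎ f y ≡ h - 1ℤ → winner x ≡ true × winner y ≡ false
    placed (inj₁ fx) (inj₂ fy) = winner-top fx , winner-bottom fy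
    placed (inj₁ fx) (inj₁ fy) with forced (trans (cong₂ _-_ fx fy) (ℤP.+-inverseʳ h))
    ... | ()
    placed (inj₂ fx) (inj₁ fy) with forced (trans (cong₂ _-_ fx fy) (step-down h))
    ... | ()
    placed (inj₂ fx) (inj₂ fy) with forced (trans (cong₂ _-_ fx fy) (ℤP.+-inverseʳ (h - 1ℤ)))
    ... | ()

  top-to-bottom⇒chosen : ∀ x y → winner x ≡ true × winner y ≡ false → c x y ≡ just x
  top-to-bottom⇒chosen x y (wx , wy) with level x | level y
  ... | inj₂ fx | _ rewrite winner-bottom fx with wx
  ...   | ()
  top-to-bottom⇒chosen x y (wx , wy) | inj₁ fx | inj₁ fy rewrite winner-top fy with wy
  ...   | ()
  top-to-bottom⇒chosen x y (wx , wy) | inj₁ fx | inj₂ fy =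
    W≡1⇒chooses x y c (trans (potential x y) (trans (cong₂ _-_ fx fy) (up h)))
    where up : ∀ a → a - (a - 1ℤ) ≡ 1ℤ
          up = solve-∀

  levels⇒partisan : (∃ λ x → f x ≡ h) → (∃ λ x → f x ≡ h - 1ℤ) → Partisan c
  levels⇒partisan (x₁ , top) (x₀ , bottom) =
    winner , (x₁ , winner-top top) , (x₀ , winner-bottom bottom) ,
    λ x y → mk⇔ (chosen⇒top-to-bottom x y) (top-to-bottom⇒chosen x y)

-- A choice function whose matrix has no cyclic sums is balanced or partisan:
-- W(c) x y = f x - f y with f x = W^x_0, and since all entries lie in
-- {-1,0,1}, f takes at most two adjacent values.
module _ {m : ℕ} (c : RawC (suc m)) (c-choice : IsChoice c)
         (flat : ∀ a b d → cyc (Wmat c) a b d ≡ 0ℤ) where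

  private
    f : Fin (suc m) → ℤ
    f x = W x F.zero c

    potential : ∀ x y → W x y c ≡ f x - f y
    potential = flat⇒potential (W-antisym c c-choice) flat F.zero

    f-origin : f F.zero ≡ 0ℤ
    f-origin = antisym⇒diag (W-antisym c c-choice) F.zero

    -- f cannot take both values 1 and -1, as W(c) has no entry 2.
    no-gap-of-two : ∀ {x₁ x₂} → f x₁ ≡ 1ℤ → f x₂ ≡ -1ℤ → ⊥
    no-gap-of-two {x₁} {x₂} up down with W-values x₁ x₂ c | trans (potential x₁ x₂) (cong₂ _-_ up down)
    ... | inj₁ eq        | two = 1≢2 (trans (sym eq) two)
      where 1≢2 : 1ℤ ≢ + 2
            1≢2 ()
    ... | inj₂ (inj₁ eq) | two = 0≢2 (trans (sym eq) two)
      where 0≢2 : 0ℤ ≢ + 2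
            0≢2 ()
    ... | inj₂ (inj₂ eq) | two = -1≢2 (trans (sym eq) two)
      where -1≢2 : -1ℤ ≢ + 2
            -1≢2 ()

  flat⇒balanced-or-partisan : Balanced c ⊎ Partisan c
  flat⇒balanced-or-partisan with any? (λ x → f x ℤ.≟ 1ℤ) | any? (λ x → f x ℤ.≟ -1ℤ)
  ... | yes (_ , up) | yes (_ , down) = ⊥-elim (no-gap-of-two up down)
  ... | yes (x₁ , up) | no no-down =
    inj₂ (levels⇒partisan c f 1ℤ potential level (x₁ , up) (F.zero , f-origin))
    where
    level : ∀ x → f x ≡ 1ℤ ⊎ f x ≡ 0ℤ
    level x with W-values x F.zero c
    ... | inj₁ eq        = inj₁ eq
    ... | inj₂ (inj₁ eq) = inj₂ eq
    ... | inj₂ (inj₂ eq) = ⊥-elim (no-down (x , eq))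
  ... | no no-up | yes (x₂ , down) =
    inj₂ (levels⇒partisan c f 0ℤ potential level (F.zero , f-origin) (x₂ , down))
    where
    level : ∀ x → f x ≡ 0ℤ ⊎ f x ≡ -1ℤ
    level x with W-values x F.zero c
    ... | inj₁ eq        = ⊥-elim (no-up (x , eq))
    ... | inj₂ (inj₁ eq) = inj₁ eq
    ... | inj₂ (inj₂ eq) = inj₂ eq
  ... | no no-up | no no-down = inj₁ balanced
    where
    f≡0 : ∀ x → f x ≡ 0ℤ
    f≡0 x with W-values x F.zero c
    ... | inj₁ eq        = ⊥-elim (no-up (x , eq))
    ... | inj₂ (inj₁ eq) = eq
    ... | inj₂ (inj₂ eq) = ⊥-elim (no-down (x , eq))
    balanced : Balanced c
    balanced x = trans (sum-cong (suc m) (λ y → trans (potential x y) (cong₂ _-_ (f≡0 x) (f≡0 y))))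
                       (sum-zero (suc m))

chaotic⇒triangle : ∀ {m} (c : RawC (suc m)) → IsChoice c → Chaotic c →
  Σ (Fin (suc m)) λ a → Σ (Fin (suc m)) λ b → Σ (Fin (suc m)) λ d → cyc (Wmat c) a b d ≢ 0ℤ
chaotic⇒triangle c c-choice (imbalanced , not-partisan)
  with any? (λ a → any? (λ b → any? (λ d → ¬? (cyc (Wmat c) a b d ℤ.≟ 0ℤ))))
... | yes (a , b , d , ne) = a , b , d , ne
... | no none with flat⇒balanced-or-partisan c c-choice
                     (λ a b d → decidable-stable (cyc (Wmat c) a b d ℤ.≟ 0ℤ) (λ ne → none (a , b , d , ne)))
...   | inj₁ balanced = ⊥-elim (imbalanced balanced)
...   | inj₂ partisan = ⊥-elim (not-partisan partisan)

-- rowSum u x = Σ_y u x y; for u = W(c) these are the balances of c.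
rowSum : ∀ {n} → Matrix n → Fin n → ℤ
rowSum {n} u x = sumFin n (u x)

rowSums-total : ∀ {n} {u : Matrix n} → Antisymmetric u → sumFin n (rowSum u) ≡ 0ℤ
rowSums-total {n} {u} anti = self-negating⇒0 total total≡-total
  where
  total : ℤ
  total = sumFin n (rowSum u)
  total≡-total : total ≡ - total
  total≡-total = begin
    sumFin n (λ x → sumFin n (u x))        ≡⟨ sum-swap n n u ⟩
    sumFin n (λ y → sumFin n (λ x → u x y)) ≡⟨ sum-cong n (λ y → sum-cong n (λ x → anti y x)) ⟩
    sumFin n (λ y → sumFin n (λ x → - u y x)) ≡⟨ sum-cong n (λ y → sum-neg n (u y)) ⟩
    sumFin n (λ y → - sumFin n (u y))      ≡⟨ sum-neg n (rowSum u) ⟩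
    - sumFin n (rowSum u)                  ∎
    where open ≡-Reasoning

-- An imbalanced choice function has two rows with different sums, since
-- equal row sums would all have to be zero.
imbalanced⇒unequal-rows : ∀ {n} (c : RawC n) → IsChoice c → Imbalanced c →
  Σ (Fin n) λ p → Σ (Fin n) λ q → rowSum (Wmat c) p ≢ rowSum (Wmat c) q
imbalanced⇒unequal-rows {n} c c-choice imbalanced
  with ¬∀⟶∃¬ n _ (λ x → rowSum (Wmat c) x ℤ.≟ 0ℤ) imbalanced
... | p , sp≢0 with any? (λ q → ¬? (rowSum (Wmat c) q ℤ.≟ rowSum (Wmat c) p))
...   | yes (q , sq≢sp) = p , q , λ eq → sq≢sp (sym eq)
...   | no none = ⊥-elim (sp≢0 sp≡0)
  where
  s : Fin n → ℤ
  s = rowSum (Wmat c)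
  all-equal : ∀ q → s q ≡ s p
  all-equal q = decidable-stable (s q ℤ.≟ s p) (λ ne → none (q , ne))
  n·sp≡0 : + n * s p ≡ 0ℤ
  n·sp≡0 = trans (sym (sum-const n (s p)))
                 (trans (sum-cong n (λ q → sym (all-equal q))) (rowSums-total (W-antisym c c-choice)))
  sp≡0 : s p ≡ 0ℤ
  sp≡0 with ℤP.i*j≡0⇒i≡0∨j≡0 (+ n) n·sp≡0
  ... | inj₂ eq = eq
  ... | inj₁ n≡0 with subst Fin (ℤP.+-injective n≡0) p
  ...   | ()

edge : ∀ {n} → Fin n → Fin n → Matrix n
edge a b x y = δ a x * δ b y - δ b x * δ a y

triangle : ∀ {n} → Fin n → Fin n → Fin n → Matrix n
triangle a b d x y = edge a b x y + edge b d x y + edge d a x y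

edge-relabel : ∀ {n} (π : Permutation′ n) (a b x y : Fin n) →
  edge (π ⟨$⟩ˡ a) (π ⟨$⟩ˡ b) (π ⟨$⟩ˡ x) (π ⟨$⟩ˡ y) ≡ edge a b x y
edge-relabel π a b x y
  rewrite δ-relabel π a x | δ-relabel π b y | δ-relabel π b x | δ-relabel π a y = refl

triangle-relabel : ∀ {n} (π : Permutation′ n) (a b d x y : Fin n) →
  triangle (π ⟨$⟩ˡ a) (π ⟨$⟩ˡ b) (π ⟨$⟩ˡ d) (π ⟨$⟩ˡ x) (π ⟨$⟩ˡ y) ≡ triangle a b d x y
triangle-relabel π a b d x y
  rewrite edge-relabel π a b x y | edge-relabel π b d x y | edge-relabel π d a x y = refl

edge-antisym : ∀ {n} (x y : Fin n) → Antisymmetric (λ a b → edge a b x y)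
edge-antisym x y a b = reverse (δ a x) (δ b y) (δ b x) (δ a y)
  where reverse : ∀ A B C D → C * D - A * B ≡ - (A * B - C * D)
        reverse = solve-∀

-- Multiples of one edge (resp. one triangle on distinct points) generate
-- the same multiples of all edges (resp. triangles), by transitivity.
module _ {n : ℕ} (𝒞 : Family n) (sym𝒞 : Symmetric 𝒞) (K : ℤ) where

  private
    K*0 : ∀ {z} → z ≡ 0ℤ → 0ℤ ≡ K * z
    K*0 refl = sym (ℤP.*-zeroʳ K)

  all-edges : ∀ {p q : Fin n} → p ≢ q → Span 𝒞 (λ x y → K * edge p q x y) →
    ∀ a b → Span 𝒞 (λ x y → K * edge a b x y)
  all-edges {p} {q} p≢q K·pq a b with a ≟ b
  ... | yes refl = span-ext 𝒞 (λ x y → K*0 (antisym⇒diag (edge-antisym x y) a)) (span-0 𝒞)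
  ... | no a≢b with two-transitive a≢b p≢q
  ...   | π , a↦p , b↦q = span-ext 𝒞 moved (span-relabel 𝒞 sym𝒞 π K·pq)
    where
    moved : ∀ x y → K * edge p q (π ⟨$⟩ˡ x) (π ⟨$⟩ˡ y) ≡ K * edge a b x y
    moved x y rewrite sym a↦p | sym b↦q = cong (K *_) (edge-relabel π a b x y)

  all-triangles : ∀ {u₀ u₁ u₂ : Fin n} → u₀ ≢ u₁ → u₀ ≢ u₂ → u₁ ≢ u₂ →
    Span 𝒞 (λ x y → K * triangle u₀ u₁ u₂ x y) → ∀ a b d → Span 𝒞 (λ x y → K * triangle a b d x y)
  all-triangles {u₀} {u₁} {u₂} u₀≢u₁ u₀≢u₂ u₁≢u₂ K·t a b d with a ≟ b | a ≟ d | b ≟ d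
  ... | yes refl | _ | _ = span-ext 𝒞 (λ x y → K*0 (cyc-aad (edge-antisym x y) a d)) (span-0 𝒞)
  ... | no _ | yes refl | _ = span-ext 𝒞 (λ x y → K*0 (cyc-aba (edge-antisym x y) a b)) (span-0 𝒞)
  ... | no _ | no _ | yes refl = span-ext 𝒞 (λ x y → K*0 (cyc-abb (edge-antisym x y) a b)) (span-0 𝒞)
  ... | no a≢b | no a≢d | no b≢d with three-transitive a≢b a≢d b≢d u₀≢u₁ u₀≢u₂ u₁≢u₂
  ...   | π , a↦u₀ , b↦u₁ , d↦u₂ = span-ext 𝒞 moved (span-relabel 𝒞 sym𝒞 π K·t)
    where
    moved : ∀ x y → K * triangle u₀ u₁ u₂ (π ⟨$⟩ˡ x) (π ⟨$⟩ˡ y) ≡ K * triangle a b d x y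
    moved x y rewrite sym a↦u₀ | sym b↦u₁ | sym d↦u₂ = cong (K *_) (triangle-relabel π a b d x y)

-- Antisymmetrising over the permutations of three points

module S₃ (m : ℕ) where
  n : ℕ
  n = suc (suc (suc m))

  0F 1F 2F : Fin n
  0F = F.zero
  1F = F.suc F.zero
  2F = F.suc (F.suc F.zero)

  0≢1 : 0F ≢ 1F
  0≢1 ()
  0≢2 : 0F ≢ 2F
  0≢2 ()
  1≢2 : 1F ≢ 2F
  1≢2 ()

  τ₀₁ τ₁₂ τ₀₂ κ κ² : Permutation′ n
  τ₀₁ = P.transpose 0F 1F
  τ₁₂ = P.transpose 1F 2F
  τ₀₂ = P.transpose 0F 2F
  κ   = τ₀₁ ∘ₚ τ₁₂
  κ²  = τ₁₂ ∘ₚ τ₀₁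

  antisymmetrise : Matrix n → Matrix n
  antisymmetrise V x y = V x y + relabel κ V x y + relabel κ² V x y
                       - (relabel τ₀₁ V x y + relabel τ₁₂ V x y + relabel τ₀₂ V x y)

  antisymmetrise-triangle : ∀ V → Antisymmetric V → ∀ x y →
    antisymmetrise V x y ≡ + 2 * cyc V 0F 1F 2F * triangle 0F 1F 2F x y
  antisymmetrise-triangle V anti = check
    where
    diag : ∀ x → V x x ≡ 0ℤ
    diag = antisym⇒diag anti
    a b c : ℤ
    a = V 0F 1F
    b = V 1F 2F
    c = V 2F 0F
    off-triangle : 0ℤ ≡ + 2 * cyc V 0F 1F 2F * + 0
    off-triangle = sym (ℤP.*-zeroʳ (+ 2 * cyc V 0F 1F 2F))
    check : ∀ x y → antisymmetrise V x y ≡ + 2 * cyc V 0F 1F 2F * triangle 0F 1F 2F x y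
    check F.zero F.zero rewrite diag 0F | diag 1F | diag 2F = off-triangle
    check (F.suc F.zero) (F.suc F.zero) rewrite diag 0F | diag 1F | diag 2F = off-triangle
    check (F.suc (F.suc F.zero)) (F.suc (F.suc F.zero)) rewrite diag 0F | diag 1F | diag 2F = off-triangle
    check F.zero (F.suc F.zero) rewrite anti 0F 1F | anti 1F 2F | anti 2F 0F = at01 a b c
      where at01 : ∀ a b c → a + b + c - (- a + - c + - b) ≡ + 2 * (a + b + c) * + 1
            at01 = solve-∀
    check (F.suc F.zero) (F.suc (F.suc F.zero)) rewrite anti 0F 1F | anti 1F 2F | anti 2F 0F = at12 a b c
      where at12 : ∀ a b c → b + c + a - (- c + - b + - a) ≡ + 2 * (a + b + c) * + 1
            at12 = solve-∀
    check (F.suc (F.suc F.zero)) F.zero rewrite anti 0F 1F | anti 1F 2F | anti 2F 0F = at20 a b c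
      where at20 : ∀ a b c → c + a + b - (- b + - a + - c) ≡ + 2 * (a + b + c) * + 1
            at20 = solve-∀
    check (F.suc F.zero) F.zero rewrite anti 0F 1F | anti 1F 2F | anti 2F 0F = at10 a b c
      where at10 : ∀ a b c → - a + - b + - c - (a + c + b) ≡ + 2 * (a + b + c) * -[1+ 0 ]
            at10 = solve-∀
    check (F.suc (F.suc F.zero)) (F.suc F.zero) rewrite anti 0F 1F | anti 1F 2F | anti 2F 0F = at21 a b c
      where at21 : ∀ a b c → - b + - c + - a - (c + b + a) ≡ + 2 * (a + b + c) * -[1+ 0 ]
            at21 = solve-∀
    check F.zero (F.suc (F.suc F.zero)) rewrite anti 0F 1F | anti 1F 2F | anti 2F 0F = at02 a b c
      where at02 : ∀ a b c → - c + - a + - b - (b + a + c) ≡ + 2 * (a + b + c) * -[1+ 0 ]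
            at02 = solve-∀
    -- One coordinate outside {0,1,2}: S₃ moves the other one around all
    -- of {0,1,2}, each point once by an even and once by an odd permutation.
    check F.zero y@(F.suc (F.suc (F.suc _))) = trans (vanishes (V 0F y) (V 1F y) (V 2F y)) off-triangle
      where vanishes : ∀ p q r → p + q + r - (q + p + r) ≡ 0ℤ
            vanishes = solve-∀
    check (F.suc F.zero) y@(F.suc (F.suc (F.suc _))) = trans (vanishes (V 0F y) (V 1F y) (V 2F y)) off-triangle
      where vanishes : ∀ p q r → q + r + p - (p + r + q) ≡ 0ℤ
            vanishes = solve-∀
    check (F.suc (F.suc F.zero)) y@(F.suc (F.suc (F.suc _))) = trans (vanishes (V 0F y) (V 1F y) (V 2F y)) off-triangle
      where vanishes : ∀ p q r → r + p + q - (r + q + p) ≡ 0ℤ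
            vanishes = solve-∀
    check x@(F.suc (F.suc (F.suc _))) F.zero = trans (vanishes (V x 0F) (V x 1F) (V x 2F)) off-triangle
      where vanishes : ∀ p q r → p + q + r - (q + p + r) ≡ 0ℤ
            vanishes = solve-∀
    check x@(F.suc (F.suc (F.suc _))) (F.suc F.zero) = trans (vanishes (V x 0F) (V x 1F) (V x 2F)) off-triangle
      where vanishes : ∀ p q r → q + r + p - (p + r + q) ≡ 0ℤ
            vanishes = solve-∀
    check x@(F.suc (F.suc (F.suc _))) (F.suc (F.suc F.zero)) = trans (vanishes (V x 0F) (V x 1F) (V x 2F)) off-triangle
      where vanishes : ∀ p q r → r + p + q - (r + q + p) ≡ 0ℤ
            vanishes = solve-∀
    -- Both coordinates outside {0,1,2}: every permutation fixes them.
    check x@(F.suc (F.suc (F.suc _))) y@(F.suc (F.suc (F.suc _))) = trans (fixed (V x y)) off-triangle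
      where fixed : ∀ w → w + w + w - (w + w + w) ≡ 0ℤ
            fixed = solve-∀

  triangles-in-span : (𝒞 : Family n) → Symmetric 𝒞 → NegationClosed 𝒞 →
    ∀ {v : Matrix n} → Antisymmetric v → Span 𝒞 v → ∀ {a b d} → cyc v a b d ≢ 0ℤ →
    ∀ a' b' d' → Span 𝒞 (λ x y → + 2 * cyc v a b d * triangle a' b' d' x y)
  triangles-in-span 𝒞 sym𝒞 neg {v} anti v∈ {a} {b} {d} T≢0 with cyc≢0⇒distinct anti T≢0
  ... | a≢b , a≢d , b≢d with three-transitive 0≢1 0≢2 1≢2 a≢b a≢d b≢d
  ...   | π , 0↦a , 1↦b , 2↦d =
    all-triangles 𝒞 sym𝒞 (+ 2 * cyc v a b d) 0≢1 0≢2 1≢2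
      (subst (λ T → Span 𝒞 (λ x y → + 2 * T * triangle 0F 1F 2F x y)) same-T
             (span-ext 𝒞 (antisymmetrise-triangle V V-anti) antisymmetrised))
    where
    V : Matrix n
    V = relabel π v
    V-anti : Antisymmetric V
    V-anti x y = anti (π ⟨$⟩ˡ x) (π ⟨$⟩ˡ y)
    same-T : cyc V 0F 1F 2F ≡ cyc v a b d
    same-T = cong₂ _+_ (cong₂ _+_ (cong₂ v 0↦a 1↦b) (cong₂ v 1↦b 2↦d)) (cong₂ v 2↦d 0↦a)
    image : ∀ σ → Span 𝒞 (relabel σ V)
    image σ = span-relabel 𝒞 sym𝒞 σ (span-relabel 𝒞 sym𝒞 π v∈)
    antisymmetrised : Span 𝒞 (antisymmetrise V)
    antisymmetrised =
      span-+ 𝒞 (span-+ 𝒞 (span-+ 𝒞 (span-relabel 𝒞 sym𝒞 π v∈) (image κ)) (image κ²))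
               (span-neg 𝒞 neg (span-+ 𝒞 (span-+ 𝒞 (image τ₀₁) (image τ₁₂)) (image τ₀₂)))

module Transposition {n : ℕ} (v : Matrix n) (anti : Antisymmetric v) {p q : Fin n} (p≢q : p ≢ q) where

  σ : Fin n → Fin n
  σ = PC.transpose p q

  r : Fin n → ℤ
  r y = v p y - v q y

  diag : ∀ x → v x x ≡ 0ℤ
  diag = antisym⇒diag anti

  swap-difference : ∀ a b → v a b - v (σ a) (σ b) ≡
    δ p a * r b - δ p b * r a + (δ q b * r a - δ q a * r b)
  swap-difference a b with a ≟ p
  swap-difference a b | yes refl with b ≟ p
  ... | yes refl rewrite δ-diff q a p≢q | diag a | diag q = a=b=p (v q a)
    where a=b=p : ∀ x → 0ℤ - 0ℤ ≡ 1ℤ * (0ℤ - x) - 1ℤ * (0ℤ - x) + (0ℤ * (0ℤ - x) - 0ℤ * (0ℤ - x))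
          a=b=p = solve-∀
  ... | no b≢p with b ≟ q
  ...   | yes refl rewrite δ-diff b a p≢q | diag a | diag b | anti a b = a=p,b=q (v a b)
    where a=p,b=q : ∀ x → x - (- x) ≡ 1ℤ * (x - 0ℤ) - 0ℤ * (0ℤ - (- x)) + (1ℤ * (0ℤ - (- x)) - 0ℤ * (x - 0ℤ))
          a=p,b=q = solve-∀
  ...   | no b≢q rewrite δ-diff q a p≢q = a=p (v a b) (v q b) (v q a)
    where a=p : ∀ x y z → x - y ≡ 1ℤ * (x - y) - 0ℤ * (0ℤ - z) + (0ℤ * (0ℤ - z) - 0ℤ * (x - y))
          a=p = solve-∀
  swap-difference a b | no a≢p with a ≟ q
  swap-difference a b | no a≢p | yes refl with b ≟ p
  ... | yes refl rewrite δ-diff a b p≢q | diag a | diag b | anti b a = a=q,b=p (v b a)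
    where a=q,b=p : ∀ x → - x - x ≡ 0ℤ * (0ℤ - 0ℤ) - 1ℤ * (x - 0ℤ) + (0ℤ * (x - 0ℤ) - 1ℤ * (0ℤ - (- x)))
          a=q,b=p = solve-∀
  ... | no b≢p with b ≟ a
  ...   | yes refl rewrite diag a | diag p = a=b=q (v p a)
    where a=b=q : ∀ x → 0ℤ - 0ℤ ≡ 0ℤ * (x - 0ℤ) - 0ℤ * (x - 0ℤ) + (1ℤ * (x - 0ℤ) - 1ℤ * (x - 0ℤ))
          a=b=q = solve-∀
  ...   | no b≢q = a=q (v a b) (v p b) (v p a)
    where a=q : ∀ x y z → x - y ≡ 0ℤ * (y - x) - 0ℤ * (z - 0ℤ) + (0ℤ * (z - 0ℤ) - 1ℤ * (y - x))
          a=q = solve-∀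
  swap-difference a b | no a≢p | no a≢q with b ≟ p
  ... | yes refl rewrite δ-diff q b p≢q | anti a b | anti a q = b=p (v a b) (v a q) (v q b)
    where b=p : ∀ x y z → x - y ≡ 0ℤ * (0ℤ - z) - 1ℤ * (- x - - y) + (0ℤ * (- x - - y) - 0ℤ * (0ℤ - z))
          b=p = solve-∀
  ... | no b≢p with b ≟ q
  ...   | yes refl rewrite anti a p | anti a b = b=q (v a b) (v a p) (v p b)
    where b=q : ∀ x y z → x - y ≡ 0ℤ * (z - 0ℤ) - 0ℤ * (- y - - x) + (1ℤ * (- y - - x) - 0ℤ * (z - 0ℤ))
          b=q = solve-∀
  ...   | no b≢q = untouched (v a b) (r b) (r a)
    where untouched : ∀ x y z → x - x ≡ 0ℤ * y - 0ℤ * z + (0ℤ * z - 0ℤ * y)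
          untouched = solve-∀

  -- Summing the triangles p → y → q → p weighted by r y: the edges through
  -- y collapse onto rows a and b, and the closing edge q → p collects Σ r.
  weighted-triangles : ∀ a b → sumFin n (λ y → r y * triangle p y q a b) ≡
    δ p a * r b - δ p b * r a + (δ q b * r a - δ q a * r b) + edge q p a b * sumFin n r
  weighted-triangles a b = begin
    sumFin n (λ y → r y * triangle p y q a b)
      ≡⟨ sum-cong n (λ y → expand (r y) (δ p a) (δ p b) (δ q b) (δ q a) (δ y b) (δ y a) (edge q p a b)) ⟩
    sumFin n (λ y → f y + E * r y)
      ≡⟨ sum-+ n f (λ y → E * r y) ⟩
    sumFin n f + sumFin n (λ y → E * r y)
      ≡⟨ cong₂ _+_ (trans (sum-+ n (λ y → α * (δ y b * r y) - β * (δ y a * r y)) _)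
                          (cong₂ _+_ (sum-δ₂ n α β b a r r) (sum-δ₂ n γ ε a b r r)))
                   (sum-scale n E r) ⟩
    α * r b - β * r a + (γ * r a - ε * r b) + E * sumFin n r ∎
    where
    open ≡-Reasoning
    α β γ ε E : ℤ
    α = δ p a
    β = δ p b
    γ = δ q b
    ε = δ q a
    E = edge q p a b
    f : Fin n → ℤ
    f y = α * (δ y b * r y) - β * (δ y a * r y) + (γ * (δ y a * r y) - ε * (δ y b * r y))
    expand : ∀ R α β γ ε Dyb Dya E → R * ((α * Dyb - Dya * β) + (Dya * γ - ε * Dyb) + E) ≡
      α * (Dyb * R) - β * (Dya * R) + (γ * (Dya * R) - ε * (Dyb * R)) + E * R
    expand = solve-∀

  transposition-identity : ∀ a b → v a b - v (σ a) (σ b) ≡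
    sumFin n (λ y → r y * triangle p y q a b) + (rowSum v p - rowSum v q) * edge p q a b
  transposition-identity a b = sym (begin
    sumFin n (λ y → r y * triangle p y q a b) + M * edge p q a b
      ≡⟨ cong (_+ M * edge p q a b) (weighted-triangles a b) ⟩
    X + edge q p a b * sumFin n r + M * edge p q a b
      ≡⟨ cong (λ s → X + edge q p a b * s + M * edge p q a b) Σr≡M ⟩
    X + edge q p a b * M + M * edge p q a b
      ≡⟨ edges-cancel X M (δ q a) (δ p b) (δ p a) (δ q b) ⟩
    X ≡⟨ sym (swap-difference a b) ⟩
    v a b - v (σ a) (σ b) ∎)
    where
    open ≡-Reasoning
    M X : ℤ
    M = rowSum v p - rowSum v q
    X = δ p a * r b - δ p b * r a + (δ q b * r a - δ q a * r b)
    Σr≡M : sumFin n r ≡ M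
    Σr≡M = trans (sum-+ n (v p) (λ y → - v q y)) (cong (_+_ (rowSum v p)) (sum-neg n (v q)))
    edges-cancel : ∀ X M a₁ a₂ a₃ a₄ → X + (a₁ * a₂ - a₃ * a₄) * M + M * (a₃ * a₄ - a₁ * a₂) ≡ X
    edges-cancel = solve-∀

edge-in-span : ∀ {n} (𝒞 : Family n) → Symmetric 𝒞 → NegationClosed 𝒞 →
  ∀ {v : Matrix n} → Antisymmetric v → Span 𝒞 v →
  ∀ (K : ℤ) → (∀ a b d → Span 𝒞 (λ x y → K * triangle a b d x y)) →
  ∀ {p q} → p ≢ q → Span 𝒞 (λ x y → K * (rowSum v p - rowSum v q) * edge p q x y)
edge-in-span {n} 𝒞 sym𝒞 neg {v} anti v∈ K triangles {p} {q} p≢q =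
  span-ext 𝒞 combine (span-+ 𝒞 (span-scale 𝒞 neg K swapped) (span-neg 𝒞 neg weighted))
  where
  open Transposition v anti p≢q
  M : ℤ
  M = rowSum v p - rowSum v q
  swapped : Span 𝒞 (λ x y → v x y - v (σ x) (σ y))
  swapped = span-+ 𝒞 v∈ (span-neg 𝒞 neg (span-relabel 𝒞 sym𝒞 (P.transpose q p) v∈))
  weighted : Span 𝒞 (λ x y → sumFin n (λ y′ → r y′ * (K * triangle p y′ q x y)))
  weighted = span-sum 𝒞 n _ (λ y′ → span-scale 𝒞 neg (r y′) (triangles p y′ q))
  combine : ∀ x y → K * (v x y - v (σ x) (σ y)) + - sumFin n (λ y′ → r y′ * (K * triangle p y′ q x y))
                    ≡ K * M * edge p q x y
  combine x y = begin
    K * (v x y - v (σ x) (σ y)) + - sumFin n (λ y′ → r y′ * (K * triangle p y′ q x y))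
      ≡⟨ cong₂ (λ A B → K * A + - B) (transposition-identity x y)
               (trans (sum-cong n (λ y′ → reassociate (r y′) K (triangle p y′ q x y)))
                      (sum-scale n K (λ y′ → r y′ * triangle p y′ q x y))) ⟩
    K * (S + M * edge p q x y) + - (K * S)
      ≡⟨ cancel K S M (edge p q x y) ⟩
    K * M * edge p q x y ∎
    where
    open ≡-Reasoning
    S : ℤ
    S = sumFin n (λ y′ → r y′ * triangle p y′ q x y)
    reassociate : ∀ R K T → R * (K * T) ≡ K * (R * T)
    reassociate = solve-∀
    cancel : ∀ K S M E → K * (S + M * E) + - (K * S) ≡ K * M * E
    cancel = solve-∀

-- A nonzero multiple of every edge yields a positive one, as the edge
-- b → a is the negative of the edge a → b.
positive-edges : ∀ {n} (𝒞 : Family n) (K : ℤ) → K ≢ 0ℤ → (∀ a b → Span 𝒞 (λ x y → K * edge a b x y)) →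
  Σ ℕ λ k → ∀ a b → Span 𝒞 (λ x y → + suc k * edge a b x y)
positive-edges 𝒞 (+ zero)   K≢0 edges = ⊥-elim (K≢0 refl)
positive-edges 𝒞 (+ suc k)  K≢0 edges = k , edges
positive-edges 𝒞 -[1+ k ]   K≢0 edges = k , λ a b → span-ext 𝒞 (reverse a b) (edges b a)
  where
  reverse : ∀ a b x y → -[1+ k ] * edge b a x y ≡ + suc k * edge a b x y
  reverse a b x y = trans (cong (-[1+ k ] *_) (edge-antisym x y a b)) (signs-cancel (+ suc k) (edge a b x y))
    where signs-cancel : ∀ K e → - K * - e ≡ K * e
          signs-cancel = solve-∀

uniform : ∀ {n} → ℚ → List (RawC n) → Weights n
uniform w = map (λ c → c , w)

⟦_⟧ : ℤ → ℚᵘ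
⟦ z ⟧ = mkℚᵘ z 0

⟦+⟧ : ∀ a b → ⟦ a ⟧ ℚᵘ.+ ⟦ b ⟧ ℚᵘ.≃ ⟦ a + b ⟧
⟦+⟧ a b = *≡* (ring a b)
  where ring : ∀ a b → (a * + 1 + b * + 1) * + 1 ≡ (a + b) * (+ 1 * + 1)
        ring = solve-∀

module _ {n : ℕ} (w : ℚ) where

  weightedW-uniform : ∀ (x y : Fin n) (L : List (RawC n)) →
    toℚᵘ (weightedW x y (uniform w L)) ℚᵘ.≃ ⟦ sumW L x y ⟧ ℚᵘ.* toℚᵘ w
  weightedW-uniform x y []      = ℚᵘP.≃-sym (ℚᵘP.*-zeroˡ (toℚᵘ w))
  weightedW-uniform x y (c ∷ L) = begin
    toℚᵘ ((W x y c ℚ./ 1) ℚ.* w ℚ.+ weightedW x y (uniform w L))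
      ≈⟨ ℚP.toℚᵘ-homo-+ ((W x y c ℚ./ 1) ℚ.* w) (weightedW x y (uniform w L)) ⟩
    toℚᵘ ((W x y c ℚ./ 1) ℚ.* w) ℚᵘ.+ toℚᵘ (weightedW x y (uniform w L))
      ≈⟨ ℚᵘP.+-cong (ℚᵘP.≃-trans (ℚP.toℚᵘ-homo-* (W x y c ℚ./ 1) w)
                                 (ℚᵘP.*-congʳ {toℚᵘ w} (ℚP.toℚᵘ-fromℚᵘ ⟦ W x y c ⟧)))
                    (weightedW-uniform x y L) ⟩
    ⟦ W x y c ⟧ ℚᵘ.* toℚᵘ w ℚᵘ.+ ⟦ sumW L x y ⟧ ℚᵘ.* toℚᵘ w
      ≈⟨ ℚᵘP.≃-sym (ℚᵘP.*-distribʳ-+ (toℚᵘ w) ⟦ W x y c ⟧ ⟦ sumW L x y ⟧) ⟩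
    (⟦ W x y c ⟧ ℚᵘ.+ ⟦ sumW L x y ⟧) ℚᵘ.* toℚᵘ w
      ≈⟨ ℚᵘP.*-congʳ {toℚᵘ w} (⟦+⟧ (W x y c) (sumW L x y)) ⟩
    ⟦ sumW (c ∷ L) x y ⟧ ℚᵘ.* toℚᵘ w ∎
    where open ℚᵘP.≃-Reasoning

  weightSum-uniform : ∀ (L : List (RawC n)) → toℚᵘ (weightSum (uniform w L)) ℚᵘ.≃ ⟦ + length L ⟧ ℚᵘ.* toℚᵘ w
  weightSum-uniform []      = ℚᵘP.≃-sym (ℚᵘP.*-zeroˡ (toℚᵘ w))
  weightSum-uniform (c ∷ L) = begin
    toℚᵘ (w ℚ.+ weightSum (uniform w L))
      ≈⟨ ℚP.toℚᵘ-homo-+ w (weightSum (uniform w L)) ⟩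
    toℚᵘ w ℚᵘ.+ toℚᵘ (weightSum (uniform w L))
      ≈⟨ ℚᵘP.+-cong (ℚᵘP.≃-sym (ℚᵘP.*-identityˡ (toℚᵘ w))) (weightSum-uniform L) ⟩
    ⟦ + 1 ⟧ ℚᵘ.* toℚᵘ w ℚᵘ.+ ⟦ + length L ⟧ ℚᵘ.* toℚᵘ w
      ≈⟨ ℚᵘP.≃-sym (ℚᵘP.*-distribʳ-+ (toℚᵘ w) ⟦ + 1 ⟧ ⟦ + length L ⟧) ⟩
    (⟦ + 1 ⟧ ℚᵘ.+ ⟦ + length L ⟧) ℚᵘ.* toℚᵘ w
      ≈⟨ ℚᵘP.*-congʳ {toℚᵘ w} (⟦+⟧ (+ 1) (+ length L)) ⟩
    ⟦ + 1 + + length L ⟧ ℚᵘ.* toℚᵘ w ∎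
    where open ℚᵘP.≃-Reasoning

reciprocal : ℕ → ℚ
reciprocal k = mkℚ (+ 1) k (1-coprimeTo (suc k))

reciprocal-inverse : ∀ k → ⟦ + suc k ⟧ ℚᵘ.* toℚᵘ (reciprocal k) ℚᵘ.≃ ℚᵘ.1ℚᵘ
reciprocal-inverse k = *≡* (cong (λ j → + suc j) (ring k))
  where
  ring : ∀ k → k ℕ.* 1 ℕ.* 1 ≡ k ℕ.+ 0 ℕ.* suc k ℕ.+ 0 ℕ.* suc (k ℕ.+ 0 ℕ.* suc k)
  ring = ℕ-Solver.solve-∀

positive-scaled : ∀ S k → (+ 0 ℤ.< S) ⇔ (ℚᵘ.0ℚᵘ ℚᵘ.< ⟦ S ⟧ ℚᵘ.* toℚᵘ (reciprocal k))
positive-scaled S k = mk⇔ (λ 0<S → *<* (subst (+ 0 ℤ.<_) (sym S·1·1≡S) 0<S))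
                          (λ { (*<* 0<S·1·1) → subst (+ 0 ℤ.<_) S·1·1≡S 0<S·1·1 })
  where
  S·1·1≡S : S * + 1 * + 1 ≡ S
  S·1·1≡S = trans (ℤP.*-identityʳ (S * + 1)) (ℤP.*-identityʳ S)

uniform-majority : ∀ {n} (𝒞 : Family n) (d : RawC n) (L : List (RawC n)) (k : ℕ) →
  length L ≡ suc k → All 𝒞 L → (∀ x y → (d x y ≡ just x) ⇔ (+ 0 ℤ.< sumW L x y)) → InMajCl 𝒞 d
uniform-majority {n} 𝒞 d L k |L|≡k+1 L⊆𝒞 sign = uniform w L , weights-valid L L⊆𝒞 , total , majority
  where
  w : ℚ
  w = reciprocal k
  weights-valid : ∀ L → All 𝒞 L → All (λ p → 𝒞 (proj₁ p) × 0ℚ ℚ.≤ proj₂ p × proj₂ p ℚ.≤ 1ℚ) (uniform w L)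
  weights-valid []      []          = []
  weights-valid (c ∷ L) (c∈𝒞 ∷ L⊆𝒞) = (c∈𝒞 , ℚ.*≤* (ℤ.+≤+ ℕ.z≤n) , ℚ.*≤* (ℤ.+≤+ (ℕ.s≤s ℕ.z≤n))) ∷ weights-valid L L⊆𝒞
  total : weightSum (uniform w L) ≡ 1ℚ
  total = ℚP.toℚᵘ-injective (ℚᵘP.≃-trans (weightSum-uniform w L)
            (subst (λ j → ⟦ + j ⟧ ℚᵘ.* toℚᵘ w ℚᵘ.≃ ℚᵘ.1ℚᵘ) (sym |L|≡k+1) (reciprocal-inverse k)))
  majority : ∀ x y → (d x y ≡ just x) ⇔ (0ℚ ℚ.< weightedW x y (uniform w L))
  majority x y = mk⇔
    (λ chosen → ℚP.toℚᵘ-cancel-< (ℚᵘP.<-respʳ-≃ (ℚᵘP.≃-sym (weightedW-uniform w x y L))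
                  (Equivalence.to (positive-scaled (sumW L x y) k) (Equivalence.to (sign x y) chosen))))
    (λ positive → Equivalence.from (sign x y) (Equivalence.from (positive-scaled (sumW L x y) k)
                  (ℚᵘP.<-respʳ-≃ (weightedW-uniform w x y L) (ℚP.toℚᵘ-mono-< {0ℚ} positive))))

chooses : ∀ {n} → RawC n → Fin n → Fin n → ℤ
chooses d a b = 𝟙 (≡-dec _≟_ (d a b) (just a))

edge-sum : ∀ {n} (d : RawC n) (K : ℤ) x y →
  sumFin n (λ a → sumFin n (λ b → chooses d a b * (K * edge a b x y))) ≡ K * chooses d x y - K * chooses d y x
edge-sum {n} d K x y =
  trans (sum-cong n (λ a → trans (row a) (regroup K (δ a x) (chooses d a y) (δ a y) (chooses d a x))))
        (sum-δ₂ n K K x y (λ a → chooses d a y) (λ a → chooses d a x))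
  where
  expand : ∀ I K A B C D → I * (K * (A * B - C * D)) ≡ K * A * (B * I) - K * D * (C * I)
  expand = solve-∀
  regroup : ∀ K A G D H → K * A * G - K * D * H ≡ K * (A * G) - K * (D * H)
  regroup = solve-∀
  row : ∀ a → sumFin n (λ b → chooses d a b * (K * edge a b x y)) ≡ K * δ a x * chooses d a y - K * δ a y * chooses d a x
  row a = trans (sum-cong n (λ b → expand (chooses d a b) K (δ a x) (δ b y) (δ b x) (δ a y)))
                (sum-δ₂ n (K * δ a x) (K * δ a y) y x (chooses d a) (chooses d a))

-- For K > 0, K·(chooses x y - chooses y x) is positive exactly when d
-- chooses x from {x,y}; a choice function never chooses both ways.
edge-sum-sign : ∀ {n} (d : RawC n) → IsChoice d → ∀ k (x y : Fin n) →
  (d x y ≡ just x) ⇔ (+ 0 ℤ.< + suc k * chooses d x y - + suc k * chooses d y x)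
edge-sum-sign d (d-sym , d-diag , _) k x y = mk⇔ ⇒ ⇐
  where
  K : ℤ
  K = + suc k
  only-loses : ∀ K → K * 0ℤ - K * 1ℤ ≡ - K
  only-loses = solve-∀
  not-both : d x y ≡ just x → d y x ≢ just y
  not-both dxy dyx with trans (trans (sym dxy) (d-sym x y)) dyx
  ... | refl with trans (sym (d-diag x)) dxy
  ...   | ()
  ⇒ : d x y ≡ just x → + 0 ℤ.< K * chooses d x y - K * chooses d y x
  ⇒ dxy rewrite 𝟙-yes (≡-dec _≟_ (d x y) (just x)) dxy | 𝟙-no (≡-dec _≟_ (d y x) (just y)) (not-both dxy)
              | ℤP.*-identityʳ K | ℤP.*-zeroʳ K | ℤP.+-identityʳ K = ℤ.+<+ (s≤s z≤n)
  ⇐ : + 0 ℤ.< K * chooses d x y - K * chooses d y x → d x y ≡ just x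
  ⇐ positive with ≡-dec _≟_ (d x y) (just x) | ≡-dec _≟_ (d y x) (just y)
  ... | yes dxy | _     = dxy
  ... | no _    | yes _ with subst (+ 0 ℤ.<_) (only-loses K) positive
  ...   | ()
  ⇐ positive | no _ | no _ =
    ⊥-elim (ℤP.<-irrefl refl (subst (+ 0 ℤ.<_) (ℤP.+-inverseʳ (K * 0ℤ)) positive))

-- If a negation-closed family with a member c generates a positive multiple
-- of every edge, every choice function d is a majority of it: the list for
-- Σ_{d chooses a from {a,b}} K·edge(a,b), padded by c and a list for -W(c)
-- so that it is nonempty, has the sign pattern of d.
edges⇒majority : ∀ {n} (𝒞 : Family n) → NegationClosed 𝒞 → ∀ c → 𝒞 c →
  ∀ k → (∀ a b → Span 𝒞 (λ x y → + suc k * edge a b x y)) → ∀ d → IsChoice d → InMajCl 𝒞 d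
edges⇒majority {n} 𝒞 neg c c∈𝒞 k edges d d-choice with chosen-edges | neg c c∈𝒞
  where
  chosen-edges : Span 𝒞 (λ x y → sumFin n (λ a → sumFin n (λ b → chooses d a b * (+ suc k * edge a b x y))))
  chosen-edges = span-sum 𝒞 n _ (λ a → span-sum 𝒞 n (λ b x y → chooses d a b * (+ suc k * edge a b x y))
                                               (λ b → span-scale 𝒞 neg (chooses d a b) (edges a b)))
... | L , L⊆𝒞 , L≡D | L⁻ , L⁻⊆𝒞 , L⁻≡-c =
  uniform-majority 𝒞 d (c ∷ L ++ L⁻) (length (L ++ L⁻)) refl (c∈𝒞 ∷ AllP.++⁺ L⊆𝒞 L⁻⊆𝒞) sign
  where
  K : ℤ
  K = + suc k
  padded : ∀ x y → sumW (c ∷ L ++ L⁻) x y ≡ K * chooses d x y - K * chooses d y x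
  padded x y = begin
    W x y c + sumW (L ++ L⁻) x y             ≡⟨ cong (_+_ (W x y c)) (sumW-++ L L⁻ x y) ⟩
    W x y c + (sumW L x y + sumW L⁻ x y)     ≡⟨ cong₂ (λ D E → W x y c + (D + E)) (L≡D x y) (L⁻≡-c x y) ⟩
    W x y c + (D + - W x y c)                ≡⟨ cancel (W x y c) D ⟩
    D                                        ≡⟨ edge-sum d K x y ⟩
    K * chooses d x y - K * chooses d y x    ∎
    where
    open ≡-Reasoning
    D : ℤ
    D = sumFin n (λ a → sumFin n (λ b → chooses d a b * (K * edge a b x y)))
    cancel : ∀ a D → a + (D + - a) ≡ D
    cancel = solve-∀
  sign : ∀ x y → (d x y ≡ just x) ⇔ (+ 0 ℤ.< sumW (c ∷ L ++ L⁻) x y)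
  sign x y = mk⇔ (λ dxy → subst (+ 0 ℤ.<_) (sym (padded x y)) (Equivalence.to (edge-sum-sign d d-choice k x y) dxy))
                 (λ pos → Equivalence.from (edge-sum-sign d d-choice k x y) (subst (+ 0 ℤ.<_) (padded x y) pos))

nonzero-product : ∀ {a b : ℤ} → a ≢ 0ℤ → b ≢ 0ℤ → a * b ≢ 0ℤ
nonzero-product {a} a≢0 b≢0 ab≡0 with ℤP.i*j≡0⇒i≡0∨j≡0 a ab≡0
... | inj₁ a≡0 = a≢0 a≡0
... | inj₂ b≡0 = b≢0 b≡0

-- Proof: from the chaotic member c take a triangle (a,b,e) of nonzero
-- circulation and rows p,q of W(c) with different sums; then K·edge(p,q)
-- lies in the span for K = 2·cyc(a,b,e)·(s_p - s_q) ≠ 0, hence a positive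
-- multiple of every edge does, and every choice function is a majority.
mainTheorem13 : ∀ (n : ℕ) → n ≥ 3 → (𝒞 : Family n) → IsSubsetOf𝔠 𝒞 →
                    Symmetric 𝒞 → ChaoticFamily 𝒞 →
                    ∀ (d : RawC n) → IsChoice d → InMajCl 𝒞 d
mainTheorem13 _ (s≤s (s≤s (s≤s (z≤n {n = m})))) 𝒞 sub sym𝒞 (c , c∈𝒞 , chaotic)
  with chaotic⇒triangle c (sub c c∈𝒞) chaotic | imbalanced⇒unequal-rows c (sub c c∈𝒞) (proj₁ chaotic)
... | a , b , e , T≢0 | p , q , sp≢sq = edges⇒majority 𝒞 neg c c∈𝒞 (proj₁ positive) (proj₂ positive)
  where
  open S₃ m
  neg : NegationClosed 𝒞
  neg = negation-closed (suc (suc m)) 𝒞 sub sym𝒞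
  v : Matrix n
  v = Wmat c
  anti : Antisymmetric v
  anti = W-antisym c (sub c c∈𝒞)
  v∈ : Span 𝒞 v
  v∈ = span-member 𝒞 c c∈𝒞
  p≢q : p ≢ q
  p≢q p≡q = sp≢sq (cong (rowSum v) p≡q)
  T K : ℤ
  T = + 2 * cyc v a b e
  K = T * (rowSum v p - rowSum v q)
  K≢0 : K ≢ 0ℤ
  K≢0 = nonzero-product (nonzero-product {+ 2} (λ ()) T≢0) (λ M≡0 → sp≢sq (ℤP.i-j≡0⇒i≡j _ _ M≡0))
  edge-pq : Span 𝒞 (λ x y → K * edge p q x y)
  edge-pq = edge-in-span 𝒞 sym𝒞 neg anti v∈ T (triangles-in-span 𝒞 sym𝒞 neg anti v∈ T≢0) p≢q
  positive : Σ ℕ λ k → ∀ a b → Span 𝒞 (λ x y → + suc k * edge a b x y)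
  positive = positive-edges 𝒞 K K≢0 (all-edges 𝒞 sym𝒞 K p≢q edge-pq)
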